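{- Algorithm \textsf{E} (defined below), run on an undirected graph with vertex set $[n]$, takes $O(d)$ steps, where $d$ is the maximum of the diameters of the connected components of the graph.
   Context: Each edge $e$ has two ends $e.v,e.w$ (the edge set is never changed). Each vertex $v$ has a parent $v.p$, initially $v$. Vertices are compared as integers. Each operation is performed simultaneously for all edges/vertices using values at the start of the operation. \textsc{extended-connect}: for each edge $e$, let $x=e.v.p$, $y=e.w.p$; if $y<x$ send $y$ to $e.v$ and to $x$, else send $x$ to $e.w$ and to $y$. \textsc{update}: for each vertex $v$, replace $v.p$ by the minimum of $v.p$ and the vertices sent to $v$ in the preceding \textsc{extended-connect}. \textsc{shortcut}: for each vertex $v$, replace $v.p$ by $(v.p).p$. Algorithm \textsf{E}: repeat \{\textsc{extended-connect}; \textsc{update}; \textsc{shortcut}\} until no parent changes. Each iteration is a round; a round consists of a constant number of synchronous concurrent message-passing steps, so the number of steps is within a constant factor of the number of rounds. -}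

module Defs where

open import Data.Nat using (ℕ; zero; suc; _+_; _*_; _≤_; _<_)
open import Data.Fin using (Fin)
open import Data.Fin.Properties using (_≟_; _<?_)
open import Data.List using (List; []; _∷_; concatMap; foldr)
open import Data.List.Membership.Propositional using (_∈_)
open import Data.Product using (_×_; _,_; Σ; ∃)
open import Data.Sum using (_⊎_)
open import Relation.Nullary using (yes; no; ¬_)
open import Relation.Binary.PropositionalEquality using (_≡_)

-- An undirected graph on vertex set [n] = Fin n, given by its (fixed) list of
-- edges; each edge e has two ends (e.v , e.w).
Edge : ℕ → Set
Edge n = Fin n × Fin n

Graph : ℕ → Set
Graph n = List (Edge n)

-- Parent pointers: v ↦ v.p
Parents : ℕ → Set
Parents n = Fin n → Fin n

minV : ∀ {n} → Fin n → Fin n → Fin n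
minV a b with a <? b
... | yes _ = a
... | no  _ = b

-- A message: (recipient , vertex sent)
Msg : ℕ → Set
Msg n = Fin n × Fin n

-- extended-connect, for one edge e = (v , w) with x = v.p, y = w.p:
-- if y < x send y to e.v and to x, else send x to e.w and to y.
sendsOf : ∀ {n} → Parents n → Edge n → List (Msg n)
sendsOf p (v , w) with p w <? p v
... | yes _ = (v , p w) ∷ (p v , p w) ∷ []
... | no  _ = (w , p v) ∷ (p w , p v) ∷ []

extendedConnect : ∀ {n} → Graph n → Parents n → List (Msg n)
extendedConnect E p = concatMap (sendsOf p) E

-- update: v.p := min (v.p , all vertices sent to v)
update : ∀ {n} → List (Msg n) → Parents n → Parents n
update ms p u = foldr step (p u) ms
  where
  step : _ → _ → _
  step (t , val) acc with t ≟ u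
  ... | yes _ = minV val acc
  ... | no  _ = acc

shortcut : ∀ {n} → Parents n → Parents n
shortcut p v = p (p v)

-- One round of Algorithm E (all operations synchronous).
round : ∀ {n} → Graph n → Parents n → Parents n
round E p = shortcut (update (extendedConnect E p) p)

initial : ∀ {n} → Parents n
initial v = v

iterE : ∀ {n} → Graph n → ℕ → Parents n
iterE E zero    = initial
iterE E (suc t) = round E (iterE E t)

-- Algorithm E halts after at most r rounds: some round number suc t ≤ r
-- changes no parent (the algorithm stops after the first such round).
HaltsWithin : ∀ {n} → Graph n → ℕ → Set
HaltsWithin E r =
  ∃ λ t → suc t ≤ r × (∀ v → round E (iterE E t) v ≡ iterE E t v)

data Walk {n} (E : Graph n) : Fin n → Fin n → ℕ → Set where
  here : ∀ {u} → Walk E u u zero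
  step : ∀ {u w v k} → ((u , w) ∈ E ⊎ (w , u) ∈ E) →
         Walk E w v k → Walk E u v (suc k)

Dist : ∀ {n} → Graph n → Fin n → Fin n → ℕ → Set
Dist E u v k = Walk E u v k × (∀ j → j < k → ¬ Walk E u v j)

-- d is the maximum of the diameters of the connected components, i.e. the
-- maximum distance between two vertices in the same component.
IsMaxDiameter : ∀ {n} → Graph n → ℕ → Set
IsMaxDiameter {n} E d =
  (∀ (u v : Fin n) k → Dist E u v k → k ≤ d) ×
  (∃ λ (u : Fin n) → ∃ λ (v : Fin n) → Dist E u v d)

module Submission where

-- Algorithm E halts within d + 1 rounds, so theorem9 holds with c = 1.
--
-- The proof tracks two invariants of the parent array p after t rounds:
--   * p points into the component:  every v is connected to p v;
--   * p is below the t-ball:        p v ≤ w for every w reachable from v by a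
--                                   walk of length at most t.
-- The first holds because every vertex sent to v by extended-connect is the
-- parent of a vertex connected to v.  The second grows by one per round:
-- update gives v a value ≤ p a for each neighbour a, and shortcut only lowers
-- parents further.  Since every shortest walk has length at most d, after d
-- rounds p v is below every vertex of v's component, i.e. p v is the minimum
-- of the component.  A parent array of component minima is a fixed point of a
-- round: every message sent to y equals p y, and p (p v) = p v.  Hence round
-- d + 1 changes nothing.

open import Defs
open import Data.Nat using (ℕ; _+_; _*_)
open import Data.Product using (Σ)

open import Data.Nat as ℕ using (zero; suc; z≤n; s≤s)
import Data.Nat.Properties as ℕ
open import Data.Nat.Induction using (<-rec)
open import Data.Fin using (Fin; _≤_; _<_)
open import Data.Fin.Properties using (_≟_; _<?_; _≤?_; ≤-refl; ≤-trans; ≤-antisym)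
open import Data.List using (List; []; _∷_)
open import Data.List.Membership.Propositional using (_∈_)
open import Data.List.Membership.Propositional.Properties using (∈-++⁺ˡ; ∈-++⁺ʳ; ∈-++⁻)
open import Data.List.Relation.Unary.Any using (here; there)
open import Data.Product using (_×_; _,_; ∃)
open import Data.Sum using (_⊎_; inj₁; inj₂; map₂)
open import Relation.Nullary using (yes; no; ¬_; contradiction)
open import Relation.Nullary.Decidable using (decidable-stable)
open import Relation.Binary.PropositionalEquality using (_≡_; refl; sym; trans; cong)

Conn : ∀ {n} → Graph n → Fin n → Fin n → Set
Conn E u v = ∃ λ k → Walk E u v k

Adjacent : ∀ {n} → Graph n → Fin n → Fin n → Set
Adjacent E u w = (u , w) ∈ E ⊎ (w , u) ∈ E

adjacent-sym : ∀ {n} {E : Graph n} {u w} → Adjacent E u w → Adjacent E w u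
adjacent-sym (inj₁ e) = inj₂ e
adjacent-sym (inj₂ e) = inj₁ e

walk-++ : ∀ {n} {E : Graph n} {u v w k l} →
          Walk E u v k → Walk E v w l → Walk E u w (k + l)
walk-++ here       q = q
walk-++ (step e p) q = step e (walk-++ p q)

conn-refl : ∀ {n} {E : Graph n} {u} → Conn E u u
conn-refl = _ , here

conn-trans : ∀ {n} {E : Graph n} {u v w} → Conn E u v → Conn E v w → Conn E u w
conn-trans (_ , p) (_ , q) = _ , walk-++ p q

conn-sym : ∀ {n} {E : Graph n} {u v} → Conn E u v → Conn E v u
conn-sym (_ , here)     = conn-refl
conn-sym (_ , step e p) = conn-trans (conn-sym (_ , p)) (_ , step (adjacent-sym e) here)

conn-adjacent : ∀ {n} {E : Graph n} {u w} → Adjacent E u w → Conn E u w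
conn-adjacent e = _ , step e here

-- If every shortest walk has length ≤ d, then any walk from v to w can be
-- replaced by one of length ≤ d (classically; we get it under ¬¬).
shortWalk : ∀ {n} (E : Graph n) (d : ℕ) →
            (∀ u v k → Dist E u v k → k ℕ.≤ d) →
            ∀ {v w k} → Walk E v w k → ¬ ¬ (∃ λ j → j ℕ.≤ d × Walk E v w j)
shortWalk E d diam {v} {w} {k} walk none = <-rec NoWalk noWalk k walk
  where
  NoWalk : ℕ → Set
  NoWalk k = ¬ Walk E v w k

  -- A walk with no shorter walk is a shortest walk, hence has length ≤ d.
  noWalk : ∀ k → (∀ {j} → j ℕ.< k → NoWalk j) → NoWalk k
  noWalk k shorter wk = none (k , diam v w k (wk , λ _ j<k → shorter j<k) , wk)

minV-≤ˡ : ∀ {n} (a b : Fin n) → minV a b ≤ a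
minV-≤ˡ a b with a <? b
... | yes _   = ≤-refl
... | no  a≮b = ℕ.≮⇒≥ a≮b

minV-≤ʳ : ∀ {n} (a b : Fin n) → minV a b ≤ b
minV-≤ʳ a b with a <? b
... | yes a<b = ℕ.<⇒≤ a<b
... | no  _   = ≤-refl

minV-either : ∀ {n} (a b : Fin n) → minV a b ≡ a ⊎ minV a b ≡ b
minV-either a b with a <? b
... | yes _ = inj₁ refl
... | no  _ = inj₂ refl

receive : ∀ {n} → Fin n → Msg n → Fin n → Fin n
receive u (t , val) acc with t ≟ u
... | yes _ = minV val acc
... | no  _ = acc

update-∷ : ∀ {n} (m : Msg n) ms p u → update (m ∷ ms) p u ≡ receive u m (update ms p u)
update-∷ (t , val) ms p u with t ≟ u
... | yes _ = refl
... | no  _ = refl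

update-≤-old : ∀ {n} ms (p : Parents n) u → update ms p u ≤ p u
update-≤-old []               p u = ≤-refl
update-≤-old ((t , val) ∷ ms) p u rewrite update-∷ (t , val) ms p u with t ≟ u
... | yes _ = ≤-trans (minV-≤ʳ val (update ms p u)) (update-≤-old ms p u)
... | no  _ = update-≤-old ms p u

update-≤-sent : ∀ {n} ms (p : Parents n) u val → (u , val) ∈ ms → update ms p u ≤ val
update-≤-sent ((t , val′) ∷ ms) p u val m rewrite update-∷ (t , val′) ms p u with t ≟ u | m
... | yes _ | here refl = minV-≤ˡ val (update ms p u)
... | yes _ | there m′  = ≤-trans (minV-≤ʳ val′ (update ms p u)) (update-≤-sent ms p u val m′)
... | no  _ | there m′  = update-≤-sent ms p u val m′
... | no t≢u | here refl = contradiction refl t≢u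

update-source : ∀ {n} ms (p : Parents n) u →
                update ms p u ≡ p u ⊎ (u , update ms p u) ∈ ms
update-source []               p u = inj₁ refl
update-source ((t , val) ∷ ms) p u rewrite update-∷ (t , val) ms p u with t ≟ u
... | no  _ = map₂ there (update-source ms p u)
... | yes refl with minV-either val (update ms p u)
...   | inj₁ eq rewrite eq = inj₂ (here refl)
...   | inj₂ eq rewrite eq = map₂ there (update-source ms p u)

sent-by-edge : ∀ {n} (E : Graph n) p {m e} → e ∈ E → m ∈ sendsOf p e → m ∈ extendedConnect E p
sent-by-edge (e ∷ E) p (here refl) m = ∈-++⁺ˡ m
sent-by-edge (e ∷ E) p (there i)   m = ∈-++⁺ʳ (sendsOf p e) (sent-by-edge E p i m)

sent-from-edge : ∀ {n} (E : Graph n) p {m} →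
                 m ∈ extendedConnect E p → ∃ λ e → e ∈ E × m ∈ sendsOf p e
sent-from-edge (e ∷ E) p m with ∈-++⁻ (sendsOf p e) m
... | inj₁ m′ = e , here refl , m′
... | inj₂ m′ with sent-from-edge E p m′
...   | e′ , i , m″ = e′ , there i , m″

PointsIntoComponent : ∀ {n} → Graph n → Parents n → Set
PointsIntoComponent E p = ∀ v → Conn E v (p v)

sent-is-parent : ∀ {n} (E : Graph n) p → PointsIntoComponent E p →
                 ∀ {t val} → (t , val) ∈ extendedConnect E p → ∃ λ b → val ≡ p b × Conn E t b
sent-is-parent E p into m with sent-from-edge E p m
... | (a , b) , ab , m′ with p b <? p a | m′
...   | yes _ | here refl         = b , refl , conn-adjacent (inj₁ ab)
...   | yes _ | there (here refl) = b , refl , conn-trans (conn-sym (into a)) (conn-adjacent (inj₁ ab))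
...   | no  _ | here refl         = a , refl , conn-adjacent (inj₂ ab)
...   | no  _ | there (here refl) = a , refl , conn-trans (conn-sym (into b)) (conn-adjacent (inj₂ ab))

edge-sends : ∀ {n} (p : Parents n) v w →
             (p w < p v × (v , p w) ∈ sendsOf p (v , w)) ⊎
             (¬ p w < p v × (w , p v) ∈ sendsOf p (v , w))
edge-sends p v w with p w <? p v
... | yes w<v = inj₁ (w<v , here refl)
... | no  w≮v = inj₂ (w≮v , here refl)

-- After update, v's parent is at most the parent of each neighbour a: either
-- p a is sent to v along the edge, or p v ≤ p a already.
update-≤-neighbour : ∀ {n} (E : Graph n) p v a →
                     Adjacent E v a → update (extendedConnect E p) p v ≤ p a
update-≤-neighbour E p v a (inj₁ va) with edge-sends p v a
... | inj₁ (_ , m)   = update-≤-sent (extendedConnect E p) p v (p a) (sent-by-edge E p va m)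
... | inj₂ (a≮v , _) = ≤-trans (update-≤-old (extendedConnect E p) p v) (ℕ.≮⇒≥ a≮v)
update-≤-neighbour E p v a (inj₂ av) with edge-sends p a v
... | inj₁ (v<a , _) = ≤-trans (update-≤-old (extendedConnect E p) p v) (ℕ.<⇒≤ v<a)
... | inj₂ (_ , m)   = update-≤-sent (extendedConnect E p) p v (p a) (sent-by-edge E p av m)

BelowBall : ∀ {n} → Graph n → ℕ → Parents n → Set
BelowBall E t p = ∀ v w k → k ℕ.≤ t → Walk E v w k → p v ≤ w

-- Updated parents come from the component, and shortcut composes two such steps.
round-into : ∀ {n} (E : Graph n) p → PointsIntoComponent E p → PointsIntoComponent E (round E p)
round-into E p into v = conn-trans (updated v) (updated (update ms p v))
  where
  ms : List (Msg _)
  ms = extendedConnect E p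

  updated : ∀ v → Conn E v (update ms p v)
  updated v with update-source ms p v
  ... | inj₁ eq rewrite eq = into v
  ... | inj₂ m with sent-is-parent E p into m
  ...   | b , eq , c rewrite eq = conn-trans c (into b)

-- A walk of length k + 1 from v starts at a neighbour a with p a ≤ its k-ball;
-- update puts v below p a, and shortcut only lowers the value further.
round-below : ∀ {n} (E : Graph n) t p → BelowBall E t p → BelowBall E (suc t) (round E p)
round-below E t p below v w k k≤ walk =
  ≤-trans (updated-≤-self (u v)) (first-step k k≤ walk)
  where
  u : Parents _
  u = update (extendedConnect E p) p

  updated-≤-self : ∀ x → u x ≤ x
  updated-≤-self x = ≤-trans (update-≤-old (extendedConnect E p) p x) (below x x 0 z≤n here)

  first-step : ∀ k → k ℕ.≤ suc t → Walk E v w k → u v ≤ w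
  first-step .0 _ here = updated-≤-self v
  first-step (suc k) (s≤s k≤t) (step {w = a} e rest) =
    ≤-trans (update-≤-neighbour E p v a e) (below a w k k≤t rest)

iterE-into : ∀ {n} (E : Graph n) t → PointsIntoComponent E (iterE E t)
iterE-into E zero    v = conn-refl
iterE-into E (suc t)   = round-into E (iterE E t) (iterE-into E t)

iterE-below : ∀ {n} (E : Graph n) t → BelowBall E t (iterE E t)
iterE-below E zero    v w .0 z≤n here = ≤-refl
iterE-below E (suc t)                 = round-below E t (iterE E t) (iterE-below E t)

ComponentMin : ∀ {n} → Graph n → Parents n → Set
ComponentMin E p = ∀ v w → Conn E v w → p v ≤ w

below-diameter : ∀ {n} (E : Graph n) d p → (∀ u v k → Dist E u v k → k ℕ.≤ d) →
                 BelowBall E d p → ComponentMin E p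
below-diameter E d p diam below v w (_ , walk) =
  decidable-stable (p v ≤? w) λ p≰w →
    shortWalk E d diam walk λ { (j , j≤d , wj) → p≰w (below v w j j≤d wj) }

round-fixed : ∀ {n} (E : Graph n) p → PointsIntoComponent E p → ComponentMin E p →
              ∀ v → round E p v ≡ p v
round-fixed E p into min v = trans (unchanged (update ms p v)) (trans (cong p (unchanged v)) idem)
  where
  ms : List (Msg _)
  ms = extendedConnect E p

  same-parent : ∀ {x y} → Conn E x y → p x ≡ p y
  same-parent c = ≤-antisym (min _ _ (conn-trans c (into _)))
                            (min _ _ (conn-trans (conn-sym c) (into _)))

  unchanged : ∀ y → update ms p y ≡ p y
  unchanged y with update-source ms p y
  ... | inj₁ eq = eq
  ... | inj₂ m with sent-is-parent E p into m
  ...   | b , eq , c = trans eq (sym (same-parent c))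

  idem : p (p v) ≡ p v
  idem = sym (same-parent (into v))

theorem9 : Σ ℕ λ c → (n : ℕ) (E : Graph n) (d : ℕ) →
    IsMaxDiameter E d → HaltsWithin E (c * d + c)
theorem9 = 1 , λ n E d (diam , _) →
  d , d+1≤1*d+1 d ,
  round-fixed E (iterE E d) (iterE-into E d)
    (below-diameter E d (iterE E d) diam (iterE-below E d))
  where
  d+1≤1*d+1 : ∀ d → suc d ℕ.≤ 1 * d + 1
  d+1≤1*d+1 d rewrite ℕ.*-identityˡ d | ℕ.+-comm d 1 = ℕ.≤-refl
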